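{- Let $n,k$ be positive integers such that $s^{n,k}=\frac{n(n+1)}{2k}$ is an integer. Let $\mathcal P=[p_1,\ldots,p_k]$ be an ascending partition of $n$ of size $k$ of the form $\mathcal P=[2^e,p^f,\ldots]$ with $e,f>0$ and $p\ge 3$, i.e. $p_1=\cdots=p_e=2$, $p_{e+1}=\cdots=p_{e+f}=p$, and $p_i>p$ for all $i>e+f$. Let $c=s^{n,k}-n$, $C=\{x\in[n]: x\ge c\}$, and $h=|C|-2e=2n-s^{n,k}+1-2e$. Suppose $f>h$ and $$\sum_{i=c-p(f-h)}^{c-1} i<(f-h)\,s^{n,k}.$$ Then $\mathcal P$ is not equitable.
   Context: $[n]=\{1,\ldots,n\}$. An ascending partition of $n$ of size $k$ is a sequence of positive integers $p_1\le p_2\le\cdots\le p_k$ with $\sum_i p_i=n$. The notation $[q_1^{e_1},q_2^{e_2},\ldots,q_t^{e_t}]$ with $q_1<q_2<\cdots<q_t$ denotes the ascending partition having exactly $e_i$ parts equal to $q_i$. The ascending partition $[p_1,\ldots,p_k]$ is equitable if $[n]$ can be partitioned into sets $A_1,\ldots,A_k$ with $|A_i|=p_i$ for all $i$ and all the element sums $\sum_{a\in A_i}a$ equal (necessarily to $s^{n,k}$). -}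

module Defs where

open import Data.Nat as ℕ using (ℕ; zero; suc; _≤_; _<_)
open import Data.Integer as ℤ using (ℤ; +_; -[1+_])
open import Data.Fin as Fin using (Fin; toℕ)
open import Data.List using (List; []; _∷_; length; filter; map; allFin)
open import Data.Nat.ListAction using (sum)
open import Relation.Binary.PropositionalEquality using (_≡_)
open import Data.Product using (Σ; _×_)

-- Element x : Fin n represents the number toℕ x + 1 ∈ [n].
elem : {n : ℕ} → Fin n → ℕ
elem x = suc (toℕ x)

-- A partition of n into k parts, given as P : Fin k → ℕ (P i = p_{i+1}).
-- Ascending partition of n of size k: positive parts, non-decreasing, summing to n.
IsAscendingPartition : (n k : ℕ) → (Fin k → ℕ) → Set
IsAscendingPartition n k P =
  ((i : Fin k) → 0 < P i) ×
  (((i j : Fin k) → i Fin.≤ j → P i ≤ P j) ×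
   (sum (map P (allFin k)) ≡ n))

-- An assignment a : Fin n → Fin k puts the number (elem x) into block A_{a x}.
blockElems : {n k : ℕ} → (Fin n → Fin k) → Fin k → List (Fin n)
blockElems {n} a i = filter (λ x → a x Fin.≟ i) (allFin n)

blockSize : {n k : ℕ} → (Fin n → Fin k) → Fin k → ℕ
blockSize a i = length (blockElems a i)

blockSum : {n k : ℕ} → (Fin n → Fin k) → Fin k → ℕ
blockSum a i = sum (map elem (blockElems a i))

Equitable : (n k : ℕ) → (Fin k → ℕ) → Set
Equitable n k P =
  Σ (Fin n → Fin k) λ a →
    ((i : Fin k) → blockSize a i ≡ P i) ×
    ((i j : Fin k) → blockSum a i ≡ blockSum a j)

HasForm : {k : ℕ} → (Fin k → ℕ) → (e f q : ℕ) → Set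
HasForm {k} P e f q =
  (e ℕ.+ f ≤ k) ×
  (((i : Fin k) → toℕ i < e → P i ≡ 2) ×
   (((i : Fin k) → e ≤ toℕ i → toℕ i < e ℕ.+ f → P i ≡ q) ×
    ((i : Fin k) → e ℕ.+ f ≤ toℕ i → q < P i)))

intervalSum : ℤ → ℕ → ℤ
intervalSum a zero = + 0
intervalSum a (suc m) = a ℤ.+ intervalSum (a ℤ.+ + 1) m

sumRange : ℤ → ℤ → ℤ
sumRange lo hi with (hi ℤ.+ + 1) ℤ.- lo
... | + m = intervalSum lo m
... | -[1+ _ ] = + 0

cVal : (n s : ℕ) → ℤ
cVal n s = + s ℤ.- + n

Ccard : (n : ℕ) → ℤ → ℕ
Ccard n c = length (filter (λ x → c ℤ.≤? + elem x) (allFin n))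

hVal : (n s e : ℕ) → ℤ
hVal n s e = + Ccard n (cVal n s) ℤ.- + (2 ℕ.* e)

-- Every block of an equitable partition sums to s = n(n+1)/2k. A block {x, y} of size 2 has
-- x = s − y ≥ s − n = c, so the e pairs use 2e elements of C = {x ≥ c}, at most h = |C| − 2e of
-- the f blocks of size q meet C, and at least t = f − h of them lie entirely below c. If m ≥ t
-- such blocks exist, their qm elements are distinct numbers below c adding up to ms, whence
-- ms ≤ (c − qm) + ⋯ + (c − 1). Dividing by m gives s ≤ q(c − (qm + 1)/2), which decreases in m,
-- while the hypothesis (c − qt) + ⋯ + (c − 1) < ts says that it is already below s at m = t.
module Submission where

open import Defs
open import Algebra.Properties.CommutativeSemigroup using (x∙yz≈y∙xz)
open import Data.Bool using (Bool; true; false; T)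
open import Data.Fin as Fin using (Fin; toℕ; inject₁; fromℕ; _≟_)
open import Data.Fin.Properties using (toℕ-inject₁; toℕ-fromℕ; toℕ<n)
open import Data.Integer as ℤ using (ℤ; +_; _⊖_)
import Data.Integer.Properties as ℤ
import Data.Integer.Tactic.RingSolver as ℤ-Solver
open import Data.List using ([]; _∷_; length; filter; map; allFin; tabulate)
open import Data.Nat as ℕ using (ℕ; zero; suc; _+_; _*_; _∸_; _<_; _≤_; z≤n; s≤s; _≤?_; _<?_)
open import Data.Nat.ListAction using (sum)
open import Data.Nat.Properties hiding (_≟_)
open import Data.Nat.Tactic.RingSolver using (solve-∀)
open import Data.Product using (_×_; _,_; proj₁; proj₂; ∃-syntax)
open import Function using (_∘_; id)
open import Relation.Binary.PropositionalEquality
open import Relation.Nullary using (¬_; Dec; yes; no; does; contradiction)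
open import Relation.Nullary.Decidable using (dec-true; _×-dec_)
open import Relation.Unary using (Decidable)
open import Algebra.Properties.Semiring.Sum +-*-semiring
  using (sum-syntax; ∑-comm; ∑-distrib-+; *-distribˡ-sum; sum-init-last; sum-cong-≗; sum-replicate-zero)

𝟙 : Bool → ℕ
𝟙 true  = 1
𝟙 false = 0

-- fromWitness and toWitness are stated with isYes, which does not reduce to does on the
-- undetermined decisions that filter (and hence Ccard and blockElems) inspects.
T-does⁺ : ∀ {A : Set} (d : Dec A) → A → T (does d)
T-does⁺ d a = subst T (sym (dec-true d a)) _

T-does⁻ : ∀ {A : Set} (d : Dec A) → T (does d) → A
T-does⁻ (yes a) _ = a

T⇒𝟙≡1 : ∀ {b} → T b → 𝟙 b ≡ 1
T⇒𝟙≡1 {true} _ = refl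

𝟙*-cong : ∀ b {x y} → (T b → x ≡ y) → 𝟙 b * x ≡ 𝟙 b * y
𝟙*-cong true  x≡y = cong (_*_ 1) (x≡y _)
𝟙*-cong false _   = refl

module _ {A : Set} {P : A → Set} (P? : Decidable P) where

  sum-map-filter : ∀ (g : A → ℕ) xs →
    sum (map g (filter P? xs)) ≡ sum (map (λ x → 𝟙 (does (P? x)) * g x) xs)
  sum-map-filter g [] = refl
  sum-map-filter g (x ∷ xs) with does (P? x)
  ... | true  = cong₂ _+_ (sym (+-identityʳ (g x))) (sum-map-filter g xs)
  ... | false = sum-map-filter g xs

  length-filter≡sum : ∀ xs → length (filter P? xs) ≡ sum (map (λ x → 𝟙 (does (P? x))) xs)
  length-filter≡sum [] = refl
  length-filter≡sum (x ∷ xs) with does (P? x)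
  ... | true  = cong suc (length-filter≡sum xs)
  ... | false = length-filter≡sum xs

sum-map-tabulate : ∀ {A : Set} n (g : A → ℕ) (h : Fin n → A) →
  sum (map g (tabulate h)) ≡ ∑[ x < n ] g (h x)
sum-map-tabulate zero    g h = refl
sum-map-tabulate (suc n) g h = cong (_+_ (g (h Fin.zero))) (sum-map-tabulate n g (h ∘ Fin.suc))

sum-map-allFin : ∀ n (g : Fin n → ℕ) → sum (map g (allFin n)) ≡ ∑[ x < n ] g x
sum-map-allFin n g = sum-map-tabulate n g id

-- sum-cong-≗ with the length made explicit: it cannot be inferred through ∑[ i < n ].
∑-cong : ∀ n {f g : Fin n → ℕ} → (∀ i → f i ≡ g i) → ∑[ i < n ] f i ≡ ∑[ i < n ] g i
∑-cong n f≗g = sum-cong-≗ f≗g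

∑-mono-≤ : ∀ n {f g : Fin n → ℕ} → (∀ i → f i ≤ g i) → ∑[ i < n ] f i ≤ ∑[ i < n ] g i
∑-mono-≤ zero    f≤g = z≤n
∑-mono-≤ (suc n) f≤g = +-mono-≤ (f≤g Fin.zero) (∑-mono-≤ n (f≤g ∘ Fin.suc))

term≤∑ : ∀ n (f : Fin n → ℕ) i → f i ≤ ∑[ j < n ] f j
term≤∑ (suc n) f Fin.zero    = m≤m+n _ _
term≤∑ (suc n) f (Fin.suc i) = ≤-trans (term≤∑ n (f ∘ Fin.suc) i) (m≤n+m _ _)

∑-const : ∀ n c → ∑[ i < n ] c ≡ n * c
∑-const zero    c = refl
∑-const (suc n) c = cong (_+_ c) (∑-const n c)

∑-δ : ∀ n (j : Fin n) (v : Fin n → ℕ) → ∑[ i < n ] (𝟙 (does (j ≟ i)) * v i) ≡ v j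
∑-δ (suc n) Fin.zero    v = trans (cong₂ _+_ (+-identityʳ (v Fin.zero)) (sum-replicate-zero n)) (+-identityʳ _)
∑-δ (suc n) (Fin.suc j) v = ∑-δ n j (v ∘ Fin.suc)

∑-𝟙< : ∀ n m → m ≤ n → ∑[ i < n ] 𝟙 (does (toℕ i <? m)) ≡ m
∑-𝟙< n       zero    _         = sum-replicate-zero n
∑-𝟙< (suc n) (suc m) (s≤s m≤n) = cong suc (∑-𝟙< n m m≤n)

elem-inject₁ : ∀ {n} (x : Fin n) → elem (inject₁ x) ≡ elem x
elem-inject₁ x = cong suc (toℕ-inject₁ x)

elem-fromℕ : ∀ n → elem (fromℕ n) ≡ suc n
elem-fromℕ n = cong suc (toℕ-fromℕ n)

∑-elem : ∀ n → ∑[ x < n ] elem x * 2 ≡ n * suc n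
∑-elem zero    = refl
∑-elem (suc n) = begin
  ∑[ x < suc n ] elem x * 2                           ≡⟨ cong (_* 2) (sum-init-last {n} elem) ⟩
  (∑[ x < n ] elem (inject₁ x) + elem (fromℕ n)) * 2
    ≡⟨ cong₂ (λ u v → (u + v) * 2) (∑-cong n elem-inject₁) (elem-fromℕ n) ⟩
  (∑[ x < n ] elem x + suc n) * 2                     ≡⟨ *-distribʳ-+ 2 (∑[ x < n ] elem x) (suc n) ⟩
  ∑[ x < n ] elem x * 2 + suc n * 2                   ≡⟨ cong (_+ suc n * 2) (∑-elem n) ⟩
  n * suc n + suc n * 2                               ≡⟨ step n ⟩
  suc n * suc (suc n)                                 ∎
  where
  open ≡-Reasoning
  step : ∀ n → n * suc n + suc n * 2 ≡ suc n * suc (suc n)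
  step = solve-∀

blockTotal : {n k : ℕ} → (Fin n → Fin k) → (Fin n → ℕ) → Fin k → ℕ
blockTotal {n} a g i = ∑[ x < n ] (𝟙 (does (a x ≟ i)) * g x)

module _ {n k : ℕ} (a : Fin n → Fin k) where

  sum-map-blockElems : ∀ g i → sum (map g (blockElems a i)) ≡ blockTotal a g i
  sum-map-blockElems g i = trans (sum-map-filter (λ x → a x ≟ i) g (allFin n)) (sum-map-allFin n _)

  blockSize≡blockTotal : ∀ i → blockSize a i ≡ blockTotal a (λ _ → 1) i
  blockSize≡blockTotal i = begin
    blockSize a i
      ≡⟨ length-filter≡sum (λ x → a x ≟ i) (allFin n) ⟩
    sum (map (λ x → 𝟙 (does (a x ≟ i))) (allFin n))
      ≡⟨ sum-map-allFin n _ ⟩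
    ∑[ x < n ] 𝟙 (does (a x ≟ i))
      ≡⟨ ∑-cong n (λ x → sym (*-identityʳ (𝟙 (does (a x ≟ i))))) ⟩
    blockTotal a (λ _ → 1) i ∎
    where open ≡-Reasoning

  ∑-weighted-blockTotal : ∀ (w : Fin k → ℕ) g →
    ∑[ i < k ] (w i * blockTotal a g i) ≡ ∑[ x < n ] (w (a x) * g x)
  ∑-weighted-blockTotal w g = begin
    ∑[ i < k ] (w i * blockTotal a g i)
      ≡⟨ ∑-cong k (λ i → *-distribˡ-sum (w i) (λ x → δ x i * g x)) ⟩
    ∑[ i < k ] ∑[ x < n ] (w i * (δ x i * g x))
      ≡⟨ ∑-comm (λ i x → w i * (δ x i * g x)) ⟩
    ∑[ x < n ] ∑[ i < k ] (w i * (δ x i * g x))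
      ≡⟨ ∑-cong n (λ x → trans (∑-cong k (λ i → x∙yz≈y∙xz *-commutativeSemigroup (w i) (δ x i) (g x)))
                              (∑-δ k (a x) (λ i → w i * g x))) ⟩
    ∑[ x < n ] (w (a x) * g x) ∎
    where
    open ≡-Reasoning
    δ : Fin n → Fin k → ℕ
    δ x i = 𝟙 (does (a x ≟ i))

  ∑-blockTotal : ∀ g → ∑[ i < k ] blockTotal a g i ≡ ∑[ x < n ] g x
  ∑-blockTotal g = begin
    ∑[ i < k ] blockTotal a g i         ≡⟨ ∑-cong k (λ i → sym (*-identityˡ (blockTotal a g i))) ⟩
    ∑[ i < k ] (1 * blockTotal a g i)   ≡⟨ ∑-weighted-blockTotal (λ _ → 1) g ⟩
    ∑[ x < n ] (1 * g x)                ≡⟨ ∑-cong n (λ x → *-identityˡ (g x)) ⟩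
    ∑[ x < n ] g x                      ∎
    where open ≡-Reasoning

  term≤blockTotal : ∀ g x → g x ≤ blockTotal a g (a x)
  term≤blockTotal g x = subst (_≤ blockTotal a g (a x)) own-term
                          (term≤∑ n (λ y → 𝟙 (does (a y ≟ a x)) * g y) x)
    where
    own-term : 𝟙 (does (a x ≟ a x)) * g x ≡ g x
    own-term = trans (cong (λ b → 𝟙 b * g x) (dec-true (a x ≟ a x) refl)) (*-identityˡ (g x))

  equalBlockSums⇒≡s : ∀ {s} → s * (2 * k) ≡ n * suc n → (∀ i j → blockSum a i ≡ blockSum a j) →
    ∀ i → blockSum a i ≡ s
  equalBlockSums⇒≡s {s} s*2k≡n*[n+1] sums i =
    *-cancelʳ-≡ S s (2 * k) {{m*n≢0 2 k {{_}} {{ℕ.>-nonZero 0<k}}}} (begin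
      S * (2 * k)                ≡⟨ reorder S k ⟩
      k * S * 2                  ≡⟨ cong (_* 2) k*S≡∑elem ⟩
      ∑[ x < n ] elem x * 2      ≡⟨ ∑-elem n ⟩
      n * suc n                  ≡⟨ sym s*2k≡n*[n+1] ⟩
      s * (2 * k)                ∎)
    where
    open ≡-Reasoning
    S : ℕ
    S = blockSum a i
    0<k : 0 < k
    0<k = ≤-trans (s≤s z≤n) (toℕ<n i)
    reorder : ∀ S k → S * (2 * k) ≡ k * S * 2
    reorder = solve-∀
    k*S≡∑elem : k * S ≡ ∑[ x < n ] elem x
    k*S≡∑elem = begin
      k * S                          ≡⟨ sym (∑-const k S) ⟩
      ∑[ j < k ] S                   ≡⟨ ∑-cong k (λ j → trans (sums i j) (sum-map-blockElems elem j)) ⟩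
      ∑[ j < k ] blockTotal a elem j ≡⟨ ∑-blockTotal elem ⟩
      ∑[ x < n ] elem x              ∎

card : ∀ {n} → (Fin n → Bool) → ℕ
card {n} b = ∑[ x < n ] 𝟙 (b x)

elemSum : ∀ {n} → (Fin n → Bool) → ℕ
elemSum {n} b = ∑[ x < n ] (𝟙 (b x) * elem x)

card-scaled : ∀ {k} (b : Fin k → Bool) c → ∑[ i < k ] (𝟙 (b i) * c) ≡ c * card b
card-scaled {k} b c = begin
  ∑[ i < k ] (𝟙 (b i) * c)   ≡⟨ ∑-cong k (λ i → *-comm (𝟙 (b i)) c) ⟩
  ∑[ i < k ] (c * 𝟙 (b i))   ≡⟨ sym (*-distribˡ-sum c (𝟙 ∘ b)) ⟩
  c * card b                 ∎
  where open ≡-Reasoning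

card-last : ∀ {n} (b : Fin (suc n) → Bool) → card b ≡ card (b ∘ inject₁) + 𝟙 (b (fromℕ n))
card-last {n} b = sum-init-last {n} (𝟙 ∘ b)

elemSum-last : ∀ {n} (b : Fin (suc n) → Bool) →
  elemSum b ≡ elemSum (b ∘ inject₁) + 𝟙 (b (fromℕ n)) * suc n
elemSum-last {n} b = trans (sum-init-last {n} (λ x → 𝟙 (b x) * elem x))
  (cong₂ _+_ (∑-cong n (λ x → cong (_*_ (𝟙 (b (inject₁ x)))) (elem-inject₁ x)))
             (cong (_*_ (𝟙 (b (fromℕ n)))) (elem-fromℕ n)))

selection-step : ∀ j S N → 2 * S + j * suc j ≤ 2 * j * N →
  2 * (S + 1 * N) + (j + 1) * suc (j + 1) ≤ 2 * (j + 1) * suc N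
selection-step j S N 2S+j[j+1]≤2jN = +-cancelʳ-≤ (j * suc j) _ _ (begin
  2 * (S + 1 * N) + (j + 1) * suc (j + 1) + j * suc j ≡⟨ regroup S N j ⟩
  (2 * S + j * suc j) + (2 * N + (j + 1) * (j + 2))   ≤⟨ +-monoˡ-≤ _ 2S+j[j+1]≤2jN ⟩
  2 * j * N + (2 * N + (j + 1) * (j + 2))             ≡⟨ collect N j ⟩
  2 * (j + 1) * suc N + j * suc j                     ∎)
  where
  open ≤-Reasoning
  regroup : ∀ S N j → 2 * (S + 1 * N) + (j + 1) * suc (j + 1) + j * suc j
                    ≡ (2 * S + j * suc j) + (2 * N + (j + 1) * (j + 2))
  regroup = solve-∀
  collect : ∀ N j → 2 * j * N + (2 * N + (j + 1) * (j + 2)) ≡ 2 * (j + 1) * suc N + j * suc j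
  collect = solve-∀

-- j distinct numbers below M sum to at most (M − j) + ⋯ + (M − 1) = jM − j(j + 1)/2.
selection-bound : ∀ {n} M (b : Fin n → Bool) → (∀ x → T (b x) → elem x < M) →
  card b ≤ M × 2 * elemSum b + card b * suc (card b) ≤ 2 * card b * M
selection-bound {zero}  M b below = z≤n , z≤n
selection-bound {suc n} M b below
  rewrite card-last b | elemSum-last b with b (fromℕ n) in b-top
... | false rewrite +-identityʳ (card (b ∘ inject₁)) | +-identityʳ (elemSum (b ∘ inject₁)) =
  selection-bound M (b ∘ inject₁) (λ x → subst (_< M) (elem-inject₁ x) ∘ below (inject₁ x))
... | true =
  ≤-trans (subst (_≤ suc (suc n)) (+-comm 1 j) (s≤s (proj₁ rest))) n+2≤M ,
  ≤-trans (selection-step j (elemSum (b ∘ inject₁)) (suc n) (proj₂ rest)) (*-monoʳ-≤ (2 * (j + 1)) n+2≤M)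
  where
  j : ℕ
  j = card (b ∘ inject₁)
  n+2≤M : suc (suc n) ≤ M
  n+2≤M = subst (_< M) (elem-fromℕ n) (below (fromℕ n) (subst T (sym b-top) _))
  rest : j ≤ suc n × 2 * elemSum (b ∘ inject₁) + j * suc j ≤ 2 * j * suc n
  rest = selection-bound (suc n) (b ∘ inject₁) (λ x _ → s≤s (toℕ<n x))

intervalSum-closed : ∀ a m → + 2 ℤ.* intervalSum a m ≡ + m ℤ.* (+ 2 ℤ.* a ℤ.+ + m ℤ.- + 1)
intervalSum-closed a zero    = refl
intervalSum-closed a (suc m) = begin
  + 2 ℤ.* (a ℤ.+ I)
    ≡⟨ distrib a I ⟩
  + 2 ℤ.* a ℤ.+ + 2 ℤ.* I
    ≡⟨ cong (ℤ._+_ (+ 2 ℤ.* a)) (intervalSum-closed (a ℤ.+ + 1) m) ⟩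
  + 2 ℤ.* a ℤ.+ + m ℤ.* (+ 2 ℤ.* (a ℤ.+ + 1) ℤ.+ + m ℤ.- + 1)
    ≡⟨ collect a (+ m) ⟩
  (+ 1 ℤ.+ + m) ℤ.* (+ 2 ℤ.* a ℤ.+ (+ 1 ℤ.+ + m) ℤ.- + 1)
    ≡⟨ cong (λ u → u ℤ.* (+ 2 ℤ.* a ℤ.+ u ℤ.- + 1)) (sym (ℤ.pos-+ 1 m)) ⟩
  + suc m ℤ.* (+ 2 ℤ.* a ℤ.+ + suc m ℤ.- + 1) ∎
  where
  open ≡-Reasoning
  I : ℤ
  I = intervalSum (a ℤ.+ + 1) m
  distrib : ∀ a I → + 2 ℤ.* (a ℤ.+ I) ≡ + 2 ℤ.* a ℤ.+ + 2 ℤ.* I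
  distrib = ℤ-Solver.solve-∀
  collect : ∀ a m → + 2 ℤ.* a ℤ.+ m ℤ.* (+ 2 ℤ.* (a ℤ.+ + 1) ℤ.+ m ℤ.- + 1)
                  ≡ (+ 1 ℤ.+ m) ℤ.* (+ 2 ℤ.* a ℤ.+ (+ 1 ℤ.+ m) ℤ.- + 1)
  collect = ℤ-Solver.solve-∀

sumRange-length : ∀ lo hi m → (hi ℤ.+ + 1) ℤ.- lo ≡ + m → sumRange lo hi ≡ intervalSum lo m
sumRange-length lo hi m length≡m rewrite length≡m = refl

sumRange-top : ∀ c j →
  + 2 ℤ.* sumRange (c ℤ.- + j) (c ℤ.- + 1) ℤ.+ + j ℤ.* + suc j ≡ + 2 ℤ.* + j ℤ.* c
sumRange-top c j = begin
  + 2 ℤ.* sumRange (c ℤ.- + j) (c ℤ.- + 1) ℤ.+ + j ℤ.* + suc j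
    ≡⟨ cong₂ (λ u v → + 2 ℤ.* u ℤ.+ + j ℤ.* v) R≡I (ℤ.pos-+ 1 j) ⟩
  + 2 ℤ.* I ℤ.+ + j ℤ.* (+ 1 ℤ.+ + j)
    ≡⟨ cong (ℤ._+ + j ℤ.* (+ 1 ℤ.+ + j)) (intervalSum-closed (c ℤ.- + j) j) ⟩
  + j ℤ.* (+ 2 ℤ.* (c ℤ.- + j) ℤ.+ + j ℤ.- + 1) ℤ.+ + j ℤ.* (+ 1 ℤ.+ + j)
    ≡⟨ collect c (+ j) ⟩
  + 2 ℤ.* + j ℤ.* c ∎
  where
  open ≡-Reasoning
  I : ℤ
  I = intervalSum (c ℤ.- + j) j
  range-length : ∀ c j → (c ℤ.- + 1 ℤ.+ + 1) ℤ.- (c ℤ.- j) ≡ j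
  range-length = ℤ-Solver.solve-∀
  R≡I : sumRange (c ℤ.- + j) (c ℤ.- + 1) ≡ I
  R≡I = sumRange-length (c ℤ.- + j) (c ℤ.- + 1) j (range-length c (+ j))
  collect : ∀ c j →
    j ℤ.* (+ 2 ℤ.* (c ℤ.- j) ℤ.+ j ℤ.- + 1) ℤ.+ j ℤ.* (+ 1 ℤ.+ j) ≡ + 2 ℤ.* j ℤ.* c
  collect = ℤ-Solver.solve-∀

sumRange-top-< : ∀ M j r → sumRange (+ M ℤ.- + j) (+ M ℤ.- + 1) ℤ.< + r → 2 * j * M < 2 * r + j * suc j
sumRange-top-< M j r R<r = ℤ.drop‿+<+ (begin-strict
  + (2 * j * M)                         ≡⟨ trans (ℤ.pos-* (2 * j) M) (cong (ℤ._* + M) (ℤ.pos-* 2 j)) ⟩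
  + 2 ℤ.* + j ℤ.* + M                   ≡⟨ sym (sumRange-top (+ M) j) ⟩
  + 2 ℤ.* R ℤ.+ + j ℤ.* + suc j         <⟨ ℤ.+-monoˡ-< (+ j ℤ.* + suc j) (ℤ.*-monoˡ-<-pos (+ 2) R<r) ⟩
  + 2 ℤ.* + r ℤ.+ + j ℤ.* + suc j       ≡⟨ sym (trans (ℤ.pos-+ (2 * r) (j * suc j))
                                                     (cong₂ ℤ._+_ (ℤ.pos-* 2 r) (ℤ.pos-* j (suc j)))) ⟩
  + (2 * r + j * suc j)                 ∎)
  where
  open ℤ.≤-Reasoning
  R : ℤ
  R = sumRange (+ M ℤ.- + j) (+ M ℤ.- + 1)

sumRange-excess : ∀ q {c d : ℤ} {M t s} → c ≡ + M → d ≡ + t →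
  sumRange (c ℤ.- + q ℤ.* d) (c ℤ.- + 1) ℤ.< d ℤ.* + s →
  2 * (q * t) * M < 2 * (s * t) + q * t * suc (q * t)
sumRange-excess q {M = M} {t} {s} refl refl R<ts = sumRange-top-< M (q * t) (s * t)
  (subst₂ (λ j r → sumRange (+ M ℤ.- j) (+ M ℤ.- + 1) ℤ.< r)
          (sym (ℤ.pos-* q t)) (trans (sym (ℤ.pos-* t s)) (cong +_ (*-comm t s))) R<ts)

-- Dividing by x, the quantity 2qM − q(qx + 1) − 2s is non-increasing in x.
excess-mono : ∀ q s M {t m} → 1 ≤ t → t ≤ m →
  2 * (q * t) * M < 2 * (s * t) + q * t * suc (q * t) →
  2 * (q * m) * M < 2 * (s * m) + q * m * suc (q * m)
excess-mono q s M {t} {m} 1≤t t≤m excess-t = begin-strict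
  2 * (q * m) * M                   ≡⟨ per-block q M m ⟩
  m * (2 * q * M)                   <⟨ *-monoʳ-< m {{ℕ.>-nonZero (≤-trans 1≤t t≤m)}} per-unit ⟩
  m * (2 * s + q * suc (q * m))     ≡⟨ spread q s m ⟩
  2 * (s * m) + q * m * suc (q * m) ∎
  where
  open ≤-Reasoning
  per-block : ∀ q M m → 2 * (q * m) * M ≡ m * (2 * q * M)
  per-block = solve-∀
  spread : ∀ q s m → m * (2 * s + q * suc (q * m)) ≡ 2 * (s * m) + q * m * suc (q * m)
  spread = solve-∀
  per-unit : 2 * q * M < 2 * s + q * suc (q * m)
  per-unit = <-≤-trans
    (*-cancelˡ-< t _ _ (subst₂ _<_ (per-block q M t) (sym (spread q s t)) excess-t))
    (+-monoʳ-≤ (2 * s) (*-monoʳ-≤ q (s≤s (*-monoʳ-≤ q t≤m))))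

cVal≡⊖ : ∀ n s → cVal n s ≡ s ⊖ n
cVal≡⊖ n s = ℤ.m-n≡m⊖n s n

cVal≤ : ∀ {n s v} → s ≤ v + n → cVal n s ℤ.≤ + v
cVal≤ {n} {s} {v} s≤v+n = subst₂ ℤ._≤_ (sym (cVal≡⊖ n s))
  (trans (ℤ.⊖-≥ (m≤n+m n v)) (cong +_ (m+n∸n≡m v n))) (ℤ.⊖-monoˡ-≤ n s≤v+n)

cVal≡ : ∀ {n s} → n ≤ s → cVal n s ≡ + (s ∸ n)
cVal≡ {n} {s} n≤s = trans (cVal≡⊖ n s) (ℤ.⊖-≥ n≤s)

<cVal⇒<∸ : ∀ {n s v} → + v ℤ.< cVal n s → v < s ∸ n
<cVal⇒<∸ {n} {s} {v} v<c with n ≤? s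
... | yes n≤s = ℤ.drop‿+<+ (subst (+ v ℤ.<_) (cVal≡ n≤s) v<c)
... | no  n≰s = contradiction
  (subst (ℤ._≤ + v) (sym (trans (cVal≡⊖ n s) (ℤ.⊖-≰ n≰s))) ℤ.neg-≤-pos) (ℤ.<⇒≱ v<c)

positive-gap : ∀ {h : ℤ} {f} → h ℤ.< + f → ∃[ t ] 1 ≤ t × + f ℤ.- h ≡ + t
positive-gap {h} {f} h<f
  with + f ℤ.- h | subst (ℤ._< + f ℤ.- h) (ℤ.+-inverseʳ h) (ℤ.+-monoˡ-< (ℤ.- h) h<f)
... | + t | 0<t = t , ℤ.drop‿+<+ 0<t , refl

gap≤ : ∀ {C} e f {m t} → + f ℤ.- (+ C ℤ.- + (2 * e)) ≡ + t → f + 2 * e ≤ m + C → t ≤ m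
gap≤ {C} e f {m} {t} gap≡t f+2e≤m+C = +-cancelʳ-≤ C t m (subst (_≤ m + C) (sym t+C≡f+2e) f+2e≤m+C)
  where
  cancel : ∀ f C d → f ℤ.- (C ℤ.- d) ℤ.+ C ≡ f ℤ.+ d
  cancel = ℤ-Solver.solve-∀
  t+C≡f+2e : t + C ≡ f + 2 * e
  t+C≡f+2e = ℤ.+-injective (begin
    + (t + C)                                ≡⟨ ℤ.pos-+ t C ⟩
    + t ℤ.+ + C                              ≡⟨ cong (ℤ._+ + C) (sym gap≡t) ⟩
    + f ℤ.- (+ C ℤ.- + (2 * e)) ℤ.+ + C      ≡⟨ cancel (+ f) (+ C) (+ (2 * e)) ⟩
    + f ℤ.+ + (2 * e)                        ≡⟨ sym (ℤ.pos-+ f (2 * e)) ⟩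
    + (f + 2 * e)                            ∎)
    where open ≡-Reasoning

module LowBlocks {n k : ℕ} (a : Fin n → Fin k) {s : ℕ} (blockSum≡s : ∀ i → blockSum a i ≡ s)
                 (e f : ℕ) where

  inC? : (x : Fin n) → Dec (cVal n s ℤ.≤ + elem x)
  inC? x = cVal n s ℤ.≤? + elem x

  inC : Fin n → Bool
  inC x = does (inC? x)

  countC : Fin k → ℕ
  countC = blockTotal a (𝟙 ∘ inC)

  isLow? : (i : Fin k) → Dec (e ≤ toℕ i × toℕ i < e + f × countC i ≡ 0)
  isLow? i = e ≤? toℕ i ×-dec toℕ i <? e + f ×-dec countC i ℕ.≟ 0

  isLow : Fin k → Bool
  isLow i = does (isLow? i)

  lowBlocks : ℕ
  lowBlocks = card isLow

  partner-inC : ∀ x y → elem x + elem y ≡ s → T (inC x)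
  partner-inC x y x+y≡s =
    T-does⁺ (inC? x) (cVal≤ (subst (_≤ elem x + n) x+y≡s (+-monoʳ-≤ (elem x) (toℕ<n y))))

  pair⊆C : ∀ i → blockSize a i ≡ 2 → countC i ≡ 2
  pair⊆C i size≡2 =
    trans (sym (sum-map-blockElems a (𝟙 ∘ inC) i)) (both (blockElems a i) size≡2 (blockSum≡s i))
    where
    both : ∀ xs → length xs ≡ 2 → sum (map elem xs) ≡ s → sum (map (𝟙 ∘ inC) xs) ≡ 2
    both (x ∷ y ∷ []) _ sum≡s = cong₂ (λ u v → u + (v + 0))
      (T⇒𝟙≡1 (partner-inC x y x+y≡s)) (T⇒𝟙≡1 (partner-inC y x (trans (+-comm (elem y) (elem x)) x+y≡s)))
      where
      x+y≡s : elem x + elem y ≡ s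
      x+y≡s = trans (cong (_+_ (elem x)) (sym (+-identityʳ (elem y)))) sum≡s

  Ccard≡∑countC : Ccard n (cVal n s) ≡ ∑[ i < k ] countC i
  Ccard≡∑countC = begin
    Ccard n (cVal n s)               ≡⟨ length-filter≡sum inC? (allFin n) ⟩
    sum (map (𝟙 ∘ inC) (allFin n))   ≡⟨ sum-map-allFin n (𝟙 ∘ inC) ⟩
    ∑[ x < n ] 𝟙 (inC x)             ≡⟨ sym (∑-blockTotal a (𝟙 ∘ inC)) ⟩
    ∑[ i < k ] countC i              ∎
    where open ≡-Reasoning

  module _ (pairs : ∀ i → toℕ i < e → blockSize a i ≡ 2) where

    -- A pair holds two elements of C; any other block of size q is low or meets C.
    pointwise-count : ∀ i → 𝟙 (does (toℕ i <? e + f)) + 𝟙 (does (toℕ i <? e)) ≤ 𝟙 (isLow i) + countC i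
    pointwise-count i = by-position (toℕ i <? e) (toℕ i <? e + f)
      where
      by-position : (i<e? : Dec (toℕ i < e)) (i<e+f? : Dec (toℕ i < e + f)) →
        𝟙 (does i<e+f?) + 𝟙 (does i<e?) ≤ 𝟙 (isLow i) + countC i
      by-position (yes i<e) (yes _)     = ≤-trans (≤-reflexive (sym (pair⊆C i (pairs i i<e)))) (m≤n+m _ _)
      by-position (yes i<e) (no i≮e+f)  = contradiction (<-≤-trans i<e (m≤m+n e f)) i≮e+f
      by-position (no _)    (no _)      = z≤n
      by-position (no i≮e)  (yes i<e+f) with countC i ℕ.≟ 0
      ... | yes noC =
        ≤-trans (≤-reflexive (sym (T⇒𝟙≡1 (T-does⁺ (isLow? i) (≮⇒≥ i≮e , i<e+f , noC))))) (m≤m+n _ _)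
      ... | no  C≢0 = ≤-trans (n≢0⇒n>0 C≢0) (m≤n+m _ _)

    f+2e≤lowBlocks+∣C∣ : e + f ≤ k → f + 2 * e ≤ lowBlocks + Ccard n (cVal n s)
    f+2e≤lowBlocks+∣C∣ e+f≤k = begin
      f + 2 * e
        ≡⟨ reorder e f ⟩
      (e + f) + e
        ≡⟨ sym (cong₂ _+_ (∑-𝟙< k (e + f) e+f≤k) (∑-𝟙< k e (≤-trans (m≤m+n e f) e+f≤k))) ⟩
      ∑[ i < k ] 𝟙 (does (toℕ i <? e + f)) + ∑[ i < k ] 𝟙 (does (toℕ i <? e))
        ≡⟨ sym (∑-distrib-+ {k} (λ i → 𝟙 (does (toℕ i <? e + f))) (λ i → 𝟙 (does (toℕ i <? e)))) ⟩
      ∑[ i < k ] (𝟙 (does (toℕ i <? e + f)) + 𝟙 (does (toℕ i <? e)))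
        ≤⟨ ∑-mono-≤ k pointwise-count ⟩
      ∑[ i < k ] (𝟙 (isLow i) + countC i)
        ≡⟨ ∑-distrib-+ {k} (𝟙 ∘ isLow) countC ⟩
      lowBlocks + ∑[ i < k ] countC i
        ≡⟨ cong (_+_ lowBlocks) (sym Ccard≡∑countC) ⟩
      lowBlocks + Ccard n (cVal n s) ∎
      where
      open ≤-Reasoning
      reorder : ∀ e f → f + 2 * e ≡ (e + f) + e
      reorder = solve-∀

  low⇒<s∸n : ∀ x → T (isLow (a x)) → elem x < s ∸ n
  low⇒<s∸n x low = <cVal⇒<∸ {n} {s} (ℤ.≰⇒> x∉C)
    where
    x∉C : ¬ (cVal n s ℤ.≤ + elem x)
    x∉C c≤x = contradiction
      (subst₂ _≤_ (T⇒𝟙≡1 (T-does⁺ (inC? x) c≤x)) (proj₂ (proj₂ (T-does⁻ (isLow? (a x)) low)))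
                  (term≤blockTotal a (𝟙 ∘ inC) x))
      (λ ())

  module _ {q : ℕ} (sizes : ∀ i → e ≤ toℕ i → toℕ i < e + f → blockSize a i ≡ q) where

    card-lowElems : card (isLow ∘ a) ≡ q * lowBlocks
    card-lowElems = begin
      card (isLow ∘ a)
        ≡⟨ ∑-cong n (λ x → sym (*-identityʳ (𝟙 (isLow (a x))))) ⟩
      ∑[ x < n ] (𝟙 (isLow (a x)) * 1)
        ≡⟨ sym (∑-weighted-blockTotal a (𝟙 ∘ isLow) (λ _ → 1)) ⟩
      ∑[ i < k ] (𝟙 (isLow i) * blockTotal a (λ _ → 1) i)
        ≡⟨ ∑-cong k (λ i → 𝟙*-cong (isLow i) (low-size i)) ⟩
      ∑[ i < k ] (𝟙 (isLow i) * q)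
        ≡⟨ card-scaled isLow q ⟩
      q * lowBlocks ∎
      where
      open ≡-Reasoning
      low-size : ∀ i → T (isLow i) → blockTotal a (λ _ → 1) i ≡ q
      low-size i low with T-does⁻ (isLow? i) low
      ... | e≤i , i<e+f , _ = trans (sym (blockSize≡blockTotal a i)) (sizes i e≤i i<e+f)

    elemSum-lowElems : elemSum (isLow ∘ a) ≡ s * lowBlocks
    elemSum-lowElems = begin
      elemSum (isLow ∘ a)
        ≡⟨ sym (∑-weighted-blockTotal a (𝟙 ∘ isLow) elem) ⟩
      ∑[ i < k ] (𝟙 (isLow i) * blockTotal a elem i)
        ≡⟨ ∑-cong k (λ i → cong (_*_ (𝟙 (isLow i))) (block≡s i)) ⟩
      ∑[ i < k ] (𝟙 (isLow i) * s)
        ≡⟨ card-scaled isLow s ⟩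
      s * lowBlocks ∎
      where
      open ≡-Reasoning
      block≡s : ∀ i → blockTotal a elem i ≡ s
      block≡s i = trans (sym (sum-map-blockElems a elem i)) (blockSum≡s i)

    lowElems-bound : q * lowBlocks ≤ s ∸ n ×
      2 * (s * lowBlocks) + q * lowBlocks * suc (q * lowBlocks) ≤ 2 * (q * lowBlocks) * (s ∸ n)
    lowElems-bound rewrite sym card-lowElems | sym elemSum-lowElems =
      selection-bound (s ∸ n) (isLow ∘ a) low⇒<s∸n

theorem4p2 : (n k : ℕ) → 0 < n → 0 < k →
    (s : ℕ) → s * (2 * k) ≡ n * suc n →
    (P : Fin k → ℕ) → IsAscendingPartition n k P →
    (e f q : ℕ) → 0 < e → 0 < f → 3 ≤ q → HasForm P e f q →
    hVal n s e ℤ.< + f →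
    sumRange (cVal n s ℤ.- + q ℤ.* (+ f ℤ.- hVal n s e)) (cVal n s ℤ.- + 1)
    ℤ.< (+ f ℤ.- hVal n s e) ℤ.* + s →
    ¬ Equitable n k P
theorem4p2 n k _ _ s hs P _ e f q _ _ 3≤q (e+f≤k , two , q-sized , _) h<f hyp (a , sizes , sums)
  with positive-gap h<f
... | t , 1≤t , f-h≡t =
  <⇒≱ (excess-mono q s (s ∸ n) 1≤t t≤lowBlocks (sumRange-excess q (cVal≡ {n} {s} n≤s) f-h≡t hyp))
      (proj₂ (lowElems-bound q-blocks))
  where
  open LowBlocks a (equalBlockSums⇒≡s a {s} hs sums) e f
  q-blocks : ∀ i → e ≤ toℕ i → toℕ i < e + f → blockSize a i ≡ q
  q-blocks i e≤i i<e+f = trans (sizes i) (q-sized i e≤i i<e+f)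
  t≤lowBlocks : t ≤ lowBlocks
  t≤lowBlocks = gap≤ e f f-h≡t (f+2e≤lowBlocks+∣C∣ (λ i i<e → trans (sizes i) (two i i<e)) e+f≤k)
  n≤s : n ≤ s
  n≤s = <⇒≤ (m∸n≢0⇒n<m (m<n⇒n≢0 (≤-trans 1≤q*lowBlocks (proj₁ (lowElems-bound q-blocks)))))
    where
    1≤q*lowBlocks : 1 ≤ q * lowBlocks
    1≤q*lowBlocks = *-mono-≤ (≤-trans (s≤s z≤n) 3≤q) (≤-trans 1≤t t≤lowBlocks)
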